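{- Let $s$ be a positive integer, $i\in\{1,2,3\}$, and let $\mathcal{Z}_i=\mathcal{Z}_i(U_i,V_i)$ be the bipartite graph defined below. Let $U\subset U_i$ and $V\subset V_i$ with $|U|+|V|\ge s+2$ and $N(U)\not\subset V$. Then there exists $u\in U\setminus\{u_{s+1}\}$ such that $e(\mathcal{Z}_i[U\setminus\{u\},V])\equiv 0\pmod 2$, and there exists $u'\in U\setminus\{u_{s+1}\}$ such that $e(\mathcal{Z}_i[U\setminus\{u'\},V])\equiv 1\pmod 2$.
   Context: $\mathcal{Z}_1(U_1,V_1)$ is the bipartite graph with parts $U_1=\{u_1,\dots,u_s\}$, $V_1=\{v_1,\dots,v_s\}$ and edge set $\{u_jv_j:1\le j\le s\}$. $\mathcal{Z}_2(U_2,V_2)$ has parts $U_2=\{u_1,\dots,u_s,u_{s+1}\}$, $V_2=\{v_1,\dots,v_s\}$ and edge set $\{u_jv_j:1\le j\le s\}$. $\mathcal{Z}_3(U_3,V_3)$ has parts $U_3=\{u_1,\dots,u_s\}$, $V_3=\{v_1,\dots,v_s,v_{s+1}\}$ and edge set $\{u_jv_j:1\le j\le s\}$. (When $u_{s+1}$ is not a vertex of the graph, $U\setminus\{u_{s+1}\}=U$.) For $U\subset U_i$, $V\subset V_i$, $e(\mathcal{Z}_i[U,V])$ is the number of edges of $\mathcal{Z}_i$ with one endpoint in $U$ and the other in $V$. For a vertex set $W$, $N(W)$ is the set of vertices adjacent to some vertex of $W$. -}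

module Defs where

open import Data.Nat using (ℕ; zero; suc; _+_; _<_)
open import Data.Nat.Properties using (_≟_; _<?_)
open import Data.Fin using (Fin; toℕ)
open import Data.Fin.Subset using (Subset; _∈_; _∉_)
open import Data.Fin.Subset.Properties using (_∈?_)
open import Data.Bool using (Bool; if_then_else_; _∧_)
open import Data.Product using (Σ; _×_)
open import Relation.Binary.PropositionalEquality using (_≡_)
open import Relation.Nullary using (does)

data ZIndex : Set where
  i₁ i₂ i₃ : ZIndex

-- Number of vertices in U_i : u_1..u_s (index 0..s-1), plus u_{s+1} (index s) for i = 2.
sizeU : ZIndex → ℕ → ℕ
sizeU i₂ s = suc s
sizeU _  s = s

-- Number of vertices in V_i : v_1..v_s, plus v_{s+1} (index s) for i = 3.
sizeV : ZIndex → ℕ → ℕ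
sizeV i₃ s = suc s
sizeV _  s = s

-- Vertex u_{j+1} is encoded as j : Fin (sizeU i s), likewise v_{k+1} as k.
-- Edges of Z_i are exactly u_j v_j for 1 ≤ j ≤ s.
Adj : ∀ i s → Fin (sizeU i s) → Fin (sizeV i s) → Set
Adj i s j k = (toℕ j ≡ toℕ k) × (toℕ j < s)

adj? : ∀ i s (j : Fin (sizeU i s)) (k : Fin (sizeV i s)) → Bool
adj? i s j k = does (toℕ j ≟ toℕ k) ∧ does (toℕ j <? s)

sumFin : ∀ {n} → (Fin n → ℕ) → ℕ
sumFin {zero}  f = 0
sumFin {suc n} f = f Data.Fin.zero + sumFin (λ x → f (Data.Fin.suc x))

edges : ∀ i s → Subset (sizeU i s) → Subset (sizeV i s) → ℕ
edges i s U V =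
  sumFin (λ j → sumFin (λ k →
    if does (j ∈? U) ∧ does (k ∈? V) ∧ adj? i s j k then 1 else 0))

NbhdNotSub : ∀ i s → Subset (sizeU i s) → Subset (sizeV i s) → Set
NbhdNotSub i s U V =
  Σ (Fin (sizeV i s)) λ k → (Σ (Fin (sizeU i s)) λ j → j ∈ U × Adj i s j k) × k ∉ V

-- Deleting u_j from U lowers e(Z_i[U,V]) by 1 if v_j ∈ V and by 0 otherwise, since v_j is the
-- only neighbour of u_j. As |U| + |V| exceeds both |U_i| and |V_i|, some index j has u_j ∈ U and
-- v_j ∈ V; and N(U) ⊄ V gives some u_k ∈ U with v_k ∉ V. Deleting u_j and deleting u_k leave
-- e − 1 and e edges, which have opposite parities.
module Submission where

open import Defs
open import Data.Bool using (Bool; true; false; if_then_else_; _∧_)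
open import Data.Bool.Properties using (∧-zeroʳ; ∧-identityʳ)
open import Data.Fin using (Fin; zero; suc; toℕ; punchIn)
open import Data.Fin.Properties using (toℕ-injective; toℕ<n; punchInᵢ≢i)
open import Data.Fin.Subset using (Subset; inside; outside; _∈_; _∉_; _-_; ⁅_⁆; ∣_∣)
open import Data.Fin.Subset.Properties using (_∈?_; ∣p∣≤n; x∈p∧x≢y⇒x∈p-y; p─q⊆p)
open import Data.Nat using (ℕ; zero; suc; _+_; _≤_; _<_; _⊔_; _%_; s≤s; s≤s⁻¹)
open import Data.Nat.Properties
  using (_≟_; _<?_; +-0-commutativeMonoid; +-assoc; +-comm; +-suc; +-identityʳ;
         ≤-refl; ≤-trans; ≤-reflexive; n≤1+n; <⇒≤; <⇒≱; ⊔-lub)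
open import Data.Product using (Σ; ∃₂; _×_; _,_; proj₂)
open import Data.Sum using (_⊎_; inj₁; inj₂)
open import Data.Vec using ([]; _∷_; here; there)
open import Function using (_∘_; mk⇔)
open import Relation.Binary.PropositionalEquality
  using (_≡_; _≢_; refl; sym; trans; cong; cong₂; subst; module ≡-Reasoning)
open import Relation.Nullary using (does; contradiction)
open import Relation.Nullary.Decidable using (dec-true; dec-false; does-⇔)
open import Algebra.Properties.CommutativeMonoid.Sum +-0-commutativeMonoid
  using (sum; sum-remove; sum-cong-≗; sum-replicate-zero)

open ≡-Reasoning

sumFin≡sum : ∀ {n} (f : Fin n → ℕ) → sumFin f ≡ sum f
sumFin≡sum {zero}  f = refl
sumFin≡sum {suc n} f = cong (f zero +_) (sumFin≡sum (f ∘ suc))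

sumFin-zero : ∀ n → sumFin {n} (λ _ → 0) ≡ 0
sumFin-zero n = trans (sumFin≡sum {n} _) (sum-replicate-zero n)

sumFin-exchange : ∀ {n} (u : Fin n) {f g : Fin n → ℕ} → (∀ x → x ≢ u → f x ≡ g x)
                → sumFin f + g u ≡ f u + sumFin g
sumFin-exchange {suc n} u {f} {g} f≡g = begin
  sumFin f + g u                      ≡⟨ cong (_+ g u) (trans (sumFin≡sum f) (sum-remove f)) ⟩
  f u + sum (f ∘ punchIn u) + g u     ≡⟨ cong (λ t → f u + t + g u) (sum-cong-≗ f≡g-punched) ⟩
  f u + sum (g ∘ punchIn u) + g u     ≡⟨ +-assoc (f u) _ (g u) ⟩
  f u + (sum (g ∘ punchIn u) + g u)   ≡⟨ cong (f u +_) (+-comm _ (g u)) ⟩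
  f u + (g u + sum (g ∘ punchIn u))   ≡⟨ cong (f u +_) (trans (sumFin≡sum g) (sum-remove g)) ⟨
  f u + sumFin g                      ∎
  where
  f≡g-punched : ∀ x → f (punchIn u x) ≡ g (punchIn u x)
  f≡g-punched x = f≡g _ (punchInᵢ≢i u x)

sumFin-point : ∀ {n} (u : Fin n) {f : Fin n → ℕ} → (∀ x → x ≢ u → f x ≡ 0) → sumFin f ≡ f u
sumFin-point {n} u {f} f≡0 = begin
  sumFin f                    ≡⟨ +-identityʳ (sumFin f) ⟨
  sumFin f + 0                ≡⟨ sumFin-exchange u {g = λ _ → 0} f≡0 ⟩
  f u + sumFin {n} (λ _ → 0)  ≡⟨ cong (f u +_) (sumFin-zero n) ⟩
  f u + 0                     ≡⟨ +-identityʳ (f u) ⟩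
  f u                         ∎

x∉p-x : ∀ {n} (p : Subset n) (x : Fin n) → x ∉ p - x
x∉p-x (_ ∷ p) (suc x) (there x∈p-x) = x∉p-x p x x∈p-x

CommonIndex : ∀ {m n} → Subset m → Subset n → Set
CommonIndex P Q = ∃₂ λ j k → toℕ j ≡ toℕ k × j ∈ P × k ∈ Q

CommonIndex-there : ∀ {m n x y} {P : Subset m} {Q : Subset n}
                  → CommonIndex P Q → CommonIndex (x ∷ P) (y ∷ Q)
CommonIndex-there (j , k , j≡k , j∈P , k∈Q) = suc j , suc k , cong suc j≡k , there j∈P , there k∈Q

common-index : ∀ {m n} (P : Subset m) (Q : Subset n) → m ⊔ n < ∣ P ∣ + ∣ Q ∣ → CommonIndex P Q
common-index []          Q  large = contradiction (∣p∣≤n Q) (<⇒≱ large)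
common-index P@(_ ∷ _)   [] large =
  contradiction (∣p∣≤n P) (<⇒≱ (≤-trans large (≤-reflexive (+-identityʳ ∣ P ∣))))
common-index (inside  ∷ P) (inside  ∷ Q) _           = zero , zero , refl , here , here
common-index (inside  ∷ P) (outside ∷ Q) (s≤s large) = CommonIndex-there (common-index P Q large)
common-index (outside ∷ P) (inside  ∷ Q) large       =
  CommonIndex-there (common-index P Q (s≤s⁻¹ (≤-trans large (≤-reflexive (+-suc ∣ P ∣ ∣ Q ∣)))))
common-index (outside ∷ P) (outside ∷ Q) large       =
  CommonIndex-there (common-index P Q (<⇒≤ large))

consecutive-parities : ∀ a → (a % 2 ≡ 0 × suc a % 2 ≡ 1) ⊎ (a % 2 ≡ 1 × suc a % 2 ≡ 0)
consecutive-parities 0             = inj₁ (refl , refl)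
consecutive-parities 1             = inj₂ (refl , refl)
consecutive-parities (suc (suc a)) = consecutive-parities a

both-parities : ∀ {A : Set} {P : A → Set} (e : A → ℕ) {a b : A} → P a → P b → suc (e a) ≡ e b
              → (Σ A λ u → P u × e u % 2 ≡ 0) × (Σ A λ u → P u × e u % 2 ≡ 1)
both-parities e {a} {b} Pa Pb e[a]+1≡e[b] with consecutive-parities (e a)
... | inj₁ (even , odd) = (a , Pa , even) , (b , Pb , subst (λ t → t % 2 ≡ 1) e[a]+1≡e[b] odd)
... | inj₂ (odd , even) = (b , Pb , subst (λ t → t % 2 ≡ 0) e[a]+1≡e[b] even) , (a , Pa , odd)

indicator : Bool → ℕ
indicator b = if b then 1 else 0

module _ {m n} (A : Fin m → Fin n → Bool) where

  -- edges i s is definitionally edgeCount (adj? i s).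
  edgeCount : Subset m → Subset n → ℕ
  edgeCount U V = sumFin λ j → sumFin λ k → indicator (does (j ∈? U) ∧ does (k ∈? V) ∧ A j k)

  degreeInto : Subset n → Fin m → ℕ
  degreeInto V j = sumFin λ k → indicator (does (k ∈? V) ∧ A j k)

  edgeCount-remove : ∀ {U} V {j} → j ∈ U → edgeCount U V ≡ degreeInto V j + edgeCount (U - j) V
  edgeCount-remove {U} V {j} j∈U = begin
    edgeCount U V                                ≡⟨ +-identityʳ _ ⟨
    edgeCount U V + 0                            ≡⟨ cong (edgeCount U V +_) row-j-after ⟨
    edgeCount U V + row (does (j ∈? U - j)) j    ≡⟨ sumFin-exchange j rows-agree ⟩
    row (does (j ∈? U)) j + edgeCount (U - j) V  ≡⟨ cong (λ b → row b j + edgeCount (U - j) V) (dec-true (j ∈? U) j∈U) ⟩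
    degreeInto V j + edgeCount (U - j) V         ∎
    where
    row : Bool → Fin m → ℕ
    row b x = sumFin λ k → indicator (b ∧ does (k ∈? V) ∧ A x k)

    rows-agree : ∀ x → x ≢ j → row (does (x ∈? U)) x ≡ row (does (x ∈? U - j)) x
    rows-agree x x≢j = cong (λ b → row b x)
      (does-⇔ (mk⇔ (λ x∈U → x∈p∧x≢y⇒x∈p-y x∈U x≢j) (p─q⊆p U ⁅ j ⁆)) (x ∈? U) (x ∈? U - j))

    row-j-after : row (does (j ∈? U - j)) j ≡ 0
    row-j-after = trans (cong (λ b → row b j) (dec-false (j ∈? U - j) (x∉p-x U j))) (sumFin-zero n)

  degreeInto-sole-neighbour : ∀ V {j k} → A j k ≡ true → (∀ x → x ≢ k → A j x ≡ false)
                            → degreeInto V j ≡ indicator (does (k ∈? V))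
  degreeInto-sole-neighbour V {j} {k} j~k j≁x = trans (sumFin-point k elsewhere) (cong indicator at-k)
    where
    elsewhere : ∀ x → x ≢ k → indicator (does (x ∈? V) ∧ A j x) ≡ 0
    elsewhere x x≢k = cong indicator (trans (cong (does (x ∈? V) ∧_) (j≁x x x≢k)) (∧-zeroʳ _))

    at-k : does (k ∈? V) ∧ A j k ≡ does (k ∈? V)
    at-k = trans (cong (does (k ∈? V) ∧_) j~k) (∧-identityʳ _)

module _ {i : ZIndex} {s : ℕ} {j : Fin (sizeU i s)} {k : Fin (sizeV i s)} where

  adj?-complete : Adj i s j k → adj? i s j k ≡ true
  adj?-complete (j≡k , j<s) = cong₂ _∧_ (dec-true (toℕ j ≟ toℕ k) j≡k) (dec-true (toℕ j <? s) j<s)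

  adj?-sole-neighbour : Adj i s j k → ∀ x → x ≢ k → adj? i s j x ≡ false
  adj?-sole-neighbour (j≡k , _) x x≢k =
    cong (_∧ does (toℕ j <? s))
         (dec-false (toℕ j ≟ toℕ x) (λ j≡x → x≢k (toℕ-injective (trans (sym j≡x) j≡k))))

  edges-remove : ∀ {U} V → j ∈ U → Adj i s j k
               → edges i s U V ≡ indicator (does (k ∈? V)) + edges i s (U - j) V
  edges-remove V j∈U j~k = trans (edgeCount-remove (adj? i s) V j∈U)
    (cong (_+ _) (degreeInto-sole-neighbour (adj? i s) V (adj?-complete j~k) (adj?-sole-neighbour j~k)))

size-bound : ∀ i s → sizeU i s ⊔ sizeV i s ≤ suc s
size-bound i₁ s = ⊔-lub (n≤1+n s) (n≤1+n s)
size-bound i₂ s = ⊔-lub ≤-refl (n≤1+n s)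
size-bound i₃ s = ⊔-lub (n≤1+n s) ≤-refl

same-index⇒Adj : ∀ i s {j : Fin (sizeU i s)} {k : Fin (sizeV i s)} → toℕ j ≡ toℕ k → Adj i s j k
same-index⇒Adj i₁ s {j}     j≡k = j≡k , toℕ<n j
same-index⇒Adj i₂ s {k = k} j≡k = j≡k , subst (_< s) (sym j≡k) (toℕ<n k)
same-index⇒Adj i₃ s {j}     j≡k = j≡k , toℕ<n j

lemma2p4 : (s : ℕ) → 1 ≤ s → (i : ZIndex)
    → (U : Subset (sizeU i s)) → (V : Subset (sizeV i s))
    → suc (suc s) ≤ ∣ U ∣ + ∣ V ∣
    → NbhdNotSub i s U V
    → (Σ (Fin (sizeU i s)) λ u → (u ∈ U × toℕ u < s) × edges i s (U - u) V % 2 ≡ 0)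
    × (Σ (Fin (sizeU i s)) λ u′ → (u′ ∈ U × toℕ u′ < s) × edges i s (U - u′) V % 2 ≡ 1)
lemma2p4 s _ i U V large (k₀ , (j₀ , j₀∈U , j₀~k₀) , k₀∉V)
  with j₁ , k₁ , j₁≡k₁ , j₁∈U , k₁∈V ← common-index U V (≤-trans (s≤s (size-bound i s)) large) =
  both-parities (λ u → edges i s (U - u) V)
                (j₁∈U , proj₂ j₁~k₁) (j₀∈U , proj₂ j₀~k₀) edge-counts-consecutive
  where
  j₁~k₁ : Adj i s j₁ k₁
  j₁~k₁ = same-index⇒Adj i s j₁≡k₁

  edge-counts-consecutive : suc (edges i s (U - j₁) V) ≡ edges i s (U - j₀) V
  edge-counts-consecutive = begin
    suc (edges i s (U - j₁) V)                         ≡⟨ cong (λ b → indicator b + _) (dec-true (k₁ ∈? V) k₁∈V) ⟨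
    indicator (does (k₁ ∈? V)) + edges i s (U - j₁) V  ≡⟨ edges-remove V j₁∈U j₁~k₁ ⟨
    edges i s U V                                      ≡⟨ edges-remove V j₀∈U j₀~k₀ ⟩
    indicator (does (k₀ ∈? V)) + edges i s (U - j₀) V  ≡⟨ cong (λ b → indicator b + _) (dec-false (k₀ ∈? V) k₀∉V) ⟩
    edges i s (U - j₀) V                               ∎
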